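{- Given an $SF$-combinator $M$, the translation $[\![M]\!]_c$ has a reduction sequence to a process of the form $c\bullet\langle\!\langle M\rangle\!\rangle \mid \mathcal{R}$.
   Context: $SF$-calculus: operators $S$, $F$; rules $SMNX \to MX(NX)$, $FOMN \to M$ ($O\in\{S,F\}$), $F(XY)MN \to NXY$ ($XY$ factorable). CPC (concurrent pattern calculus) has patterns $p ::= \lambda x \mid x \mid \ulcorner x\urcorner \mid p\bullet p$, processes as in $\pi$-calculus but with input/output replaced by cases $p \to P$ (written $p$ when $P=0$), and interaction $(p\to P)\mid(q\to Q) \to \sigma P \mid \rho Q$ when the unification of $p$ and $q$ yields $(\sigma,\rho)$. The construction $\langle\!\langle\cdot\rangle\!\rangle$ maps $S\mapsto S$, $F\mapsto F$ (reserved names), $MN \mapsto \langle\!\langle M\rangle\!\rangle\bullet\langle\!\langle N\rangle\!\rangle$. $\mathcal{R}$ is the $SF$-reducing process: a parallel composition of replicated cases, e.g. $!\lambda c\bullet(S\bullet\lambda m\bullet\lambda n\bullet\lambda x)\to c\bullet(m\bullet x\bullet(n\bullet x))$, $!\lambda c\bullet(F\bullet S\bullet\lambda m\bullet\lambda n)\to c\bullet m$, $!\lambda c\bullet(F\bullet F\bullet\lambda m\bullet\lambda n)\to c\bullet m$, cases for $F$ applied to compounds $S q$, $F q$, $S p q$, $F p q$, and cases handling reduction of sub-combinators. The translation is $[\![S]\!]_c = c\bullet S\mid\mathcal{R}$, $[\![F]\!]_c = c\bullet F\mid\mathcal{R}$, $[\![MN]\!]_c = (\nu m)(\nu n)(\mathsf{ap}(c,m,n)\mid[\![M]\!]_m\mid[\![N]\!]_n)$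 with $\mathsf{ap}(c,m,n) = m\bullet\lambda x\to n\bullet\lambda y\to c\bullet(x\bullet y)\mid\mathcal{R}$. Redundant copies of $\mathcal{R}$ may be removed since $\mathcal{R}\mid\mathcal{R}$ is behaviourally equivalent to $\mathcal{R}$. -}

module Defs where

open import Data.Nat using (ℕ; zero; suc; _+_) renaming (_≡ᵇ_ to _==ℕ_)
open import Data.Bool using (Bool; true; false; _∧_; _∨_; not; if_then_else_)
open import Data.List using (List; []; _∷_; _++_)
open import Data.List.Membership.Propositional using (_∈_)
open import Data.Maybe using (Maybe; just; nothing)
open import Data.Product using (_×_; _,_; ∃-syntax)
open import Data.Sum using (_⊎_)
open import Relation.Binary.PropositionalEquality using (_≡_)
open import Relation.Nullary using (¬_)
open import Relation.Nullary.Decidable using (does)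
open import Relation.Binary.Construct.Closure.ReflexiveTransitive using (Star)

infixl 9 _·_
data SF : Set where
  S F : SF
  _·_ : SF → SF → SF

data Name : Set where
  nS nF : Name
  nm    : ℕ → Name

_==_ : Name → Name → Bool
nS   == nS   = true
nF   == nF   = true
nm i == nm j = i ==ℕ j
_    == _    = false

anyB : (Name → Bool) → List Name → Bool
anyB t []       = false
anyB t (y ∷ ys) = t y ∨ anyB t ys

_∈ᵇ_ : Name → List Name → Bool
x ∈ᵇ xs = anyB (x ==_) xs

-- CPC patterns  p ::= λx | x | ⌜x⌝ | p • p

infixl 8 _•_
data Pat : Set where
  bind : Name → Pat
  var  : Name → Pat
  prot : Name → Pat
  _•_  : Pat → Pat → Pat

isComm : Pat → Bool
isComm (var _) = true
isComm (p • q) = isComm p ∧ isComm q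
isComm _       = false

bn : Pat → List Name
bn (bind x) = x ∷ []
bn (var _)  = []
bn (prot _) = []
bn (p • q)  = bn p ++ bn q

fnPat : Pat → List Name
fnPat (bind _) = []
fnPat (var x)  = x ∷ []
fnPat (prot x) = x ∷ []
fnPat (p • q)  = fnPat p ++ fnPat q

infixr 5 _∣_
data Proc : Set where
  𝟎    : Proc
  _∣_  : Proc → Proc → Proc
  !_   : Proc → Proc
  ν    : Name → Proc → Proc
  case : Pat → Proc → Proc

drop : (Name → Bool) → List Name → List Name
drop t []       = []
drop t (y ∷ ys) = if t y then drop t ys else y ∷ drop t ys

fn : Proc → List Name
fn 𝟎          = []
fn (P ∣ Q)    = fn P ++ fn Q
fn (! P)      = fn P
fn (ν x P)    = drop (_== x) (fn P)
fn (case p P) = fnPat p ++ drop (_∈ᵇ bn p) (fn P)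

fnSub : List (Name × Pat) → List Name
fnSub []            = []
fnSub ((_ , t) ∷ σ) = fnPat t ++ fnSub σ

Sub : Set
Sub = List (Name × Pat)

lookupS : Sub → Name → Maybe Pat
lookupS []            y = nothing
lookupS ((x , t) ∷ σ) y = if y == x then just t else lookupS σ y

restrict : List Name → Sub → Sub
restrict xs []            = []
restrict xs ((x , t) ∷ σ) =
  if x ∈ᵇ xs then restrict xs σ else (x , t) ∷ restrict xs σ

-- application of a substitution to a pattern; undefined (nothing) when a
-- protected name would be mapped to a non-name
substPat : Sub → Pat → Maybe Pat
substPat σ (bind x) = just (bind x)
substPat σ (var x) with lookupS σ x
... | just t  = just t
... | nothing = just (var x)
substPat σ (prot x) with lookupS σ x
... | just (var y) = just (prot y)
... | just _       = nothing
... | nothing      = just (prot x)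
substPat σ (p • q) with substPat σ p | substPat σ q
... | just p' | just q' = just (p' • q')
... | _       | _       = nothing

anyIn : List Name → List Name → Bool
anyIn xs ys = anyB (_∈ᵇ ys) xs

-- capture-avoiding application of a substitution to a process:
-- undefined (nothing) if a binder would capture a free name of the range
-- (there is no alpha-conversion)
subst : Sub → Proc → Maybe Proc
subst σ 𝟎 = just 𝟎
subst σ (P ∣ Q) with subst σ P | subst σ Q
... | just P' | just Q' = just (P' ∣ Q')
... | _       | _       = nothing
subst σ (! P) with subst σ P
... | just P' = just (! P')
... | nothing = nothing
subst σ (ν x P) with x ∈ᵇ fnSub (restrict (x ∷ []) σ)
... | true  = nothing
... | false with subst (restrict (x ∷ []) σ) P
...   | just P' = just (ν x P')
...   | nothing = nothing
subst σ (case p P) with anyIn (bn p) (fnSub (restrict (bn p) σ))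
... | true  = nothing
... | false with substPat σ p | subst (restrict (bn p) σ) P
...   | just p' | just P' = just (case p' P')
...   | _       | _       = nothing

unify : Pat → Pat → Maybe (Sub × Sub)
unify (bind x) q = if isComm q then just ((x , q) ∷ [] , []) else nothing
unify p (bind y) = if isComm p then just ([] , (y , p) ∷ []) else nothing
unify (var x)  (var y)  = if x == y then just ([] , []) else nothing
unify (var x)  (prot y) = if x == y then just ([] , []) else nothing
unify (prot x) (var y)  = if x == y then just ([] , []) else nothing
unify (prot x) (prot y) = if x == y then just ([] , []) else nothing
unify (p₁ • p₂) (q₁ • q₂) with unify p₁ q₁ | unify p₂ q₂
... | just (σ₁ , ρ₁) | just (σ₂ , ρ₂) = just (σ₁ ++ σ₂ , ρ₁ ++ ρ₂)
... | _              | _              = nothing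
unify _ _ = nothing

-- Structural congruence (without alpha-conversion)

infix 4 _≈_
data _≈_ : Proc → Proc → Set where
  ≈-refl    : ∀ {P} → P ≈ P
  ≈-sym     : ∀ {P Q} → P ≈ Q → Q ≈ P
  ≈-trans   : ∀ {P Q R} → P ≈ Q → Q ≈ R → P ≈ R
  par-unit  : ∀ {P} → (P ∣ 𝟎) ≈ P
  par-comm  : ∀ {P Q} → (P ∣ Q) ≈ (Q ∣ P)
  par-assoc : ∀ {P Q R} → (P ∣ (Q ∣ R)) ≈ ((P ∣ Q) ∣ R)
  repl      : ∀ {P} → (! P) ≈ (P ∣ ! P)
  nu-nil    : ∀ {x} → ν x 𝟎 ≈ 𝟎
  nu-swap   : ∀ {x y P} → ν x (ν y P) ≈ ν y (ν x P)
  extrude   : ∀ {x P Q} → ¬ (x ∈ fn P) → (P ∣ ν x Q) ≈ ν x (P ∣ Q)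
  cong-par  : ∀ {P P' Q Q'} → P ≈ P' → Q ≈ Q' → (P ∣ Q) ≈ (P' ∣ Q')
  cong-repl : ∀ {P P'} → P ≈ P' → (! P) ≈ (! P')
  cong-nu   : ∀ {x P P'} → P ≈ P' → ν x P ≈ ν x P'
  cong-case : ∀ {p P P'} → P ≈ P' → case p P ≈ case p P'

infix 4 _⟶_
data _⟶_ : Proc → Proc → Set where
  interact : ∀ {p q P Q σ ρ P' Q'} →
             unify p q ≡ just (σ , ρ) →
             subst σ P ≡ just P' → subst ρ Q ≡ just Q' →
             (case p P ∣ case q Q) ⟶ (P' ∣ Q')
  red-par  : ∀ {P P' Q} → P ⟶ P' → (P ∣ Q) ⟶ (P' ∣ Q)
  red-nu   : ∀ {x P P'} → P ⟶ P' → ν x P ⟶ ν x P'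
  red-str  : ∀ {P P' Q Q'} → P ≈ P' → P' ⟶ Q' → Q' ≈ Q → P ⟶ Q

infix 4 _⟶*_
_⟶*_ : Proc → Proc → Set
_⟶*_ = Star _⟶_

⟪_⟫ : SF → Pat
⟪ S ⟫     = var nS
⟪ F ⟫     = var nF
⟪ M · N ⟫ = ⟪ M ⟫ • ⟪ N ⟫

-- The SF-reducing process R.  The explicitly given cases are Rbase;
-- the remaining cases (reduction of sub-combinators) are a parameter Rsub.

private
  c m n x y : Name
  c = nm 0
  m = nm 1
  n = nm 2
  x = nm 3
  y = nm 4

out : Name → Pat → Proc
out a p = case (var a • p) 𝟎

Rbase : Proc
Rbase =
    ! case (bind c • (var nS • bind m • bind n • bind x))
           (out c (var m • var x • (var n • var x)))
  ∣ ! case (bind c • (var nF • var nS • bind m • bind n)) (out c (var m))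
  ∣ ! case (bind c • (var nF • var nF • bind m • bind n)) (out c (var m))
  ∣ ! case (bind c • (var nF • (var nS • bind x) • bind m • bind n))
           (out c (var n • var nS • var x))
  ∣ ! case (bind c • (var nF • (var nF • bind x) • bind m • bind n))
           (out c (var n • var nF • var x))
  ∣ ! case (bind c • (var nF • (var nS • bind x • bind y) • bind m • bind n))
           (out c (var n • (var nS • var x) • var y))
  ∣ ! case (bind c • (var nF • (var nF • bind x • bind y) • bind m • bind n))
           (out c (var n • (var nF • var x) • var y))

R : Proc → Proc
R Rsub = Rbase ∣ Rsub

-- k+1 parallel copies of R
copies : Proc → ℕ → Proc
copies Q zero    = Q
copies Q (suc k) = Q ∣ copies Q k

-- The translation [[M]]_c.  Fresh names are drawn from nm k, nm (k+1), …

ap : Proc → Name → Name → Name → Name → Name → Proc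
ap ℛ a b d u v =
  case (var b • bind u) (case (var d • bind v) (out a (var u • var v))) ∣ ℛ

tr : Proc → SF → Name → ℕ → Proc
tr ℛ S       a k = out a (var nS) ∣ ℛ
tr ℛ F       a k = out a (var nF) ∣ ℛ
tr ℛ (M · N) a k =
  ν (nm k) (ν (nm (suc k))
    (ap ℛ a (nm k) (nm (suc k)) (nm (2 + k)) (nm (3 + k))
     ∣ (tr ℛ M (nm k) (4 + k) ∣ tr ℛ N (nm (suc k)) (4 + k))))

idx : Name → ℕ
idx nS     = 0
idx nF     = 0
idx (nm i) = i

-- [[M]]_c, with all generated names fresh for c
⟦_⟧ : SF → Name → Proc → Proc
⟦ M ⟧ a Rsub = tr (R Rsub) M a (suc (idx a))

Closed : Proc → Set
Closed P = ∀ z → z ∈ fn P → z ≡ nS ⊎ z ≡ nF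

module Submission where

-- A constant S or F is translated to  out c ⟪M⟫ ∣ ℛ.  An
-- application M · N is translated to  ν b ν d (ap ∣ ([[M]]_b ∣ [[N]]_d))
-- with fresh b d (and fresh u v inside ap).  By induction both components
-- reduce to outputs of ⟪M⟫ on b and ⟪N⟫ on d; the two nested cases of ap
-- receive them in two interactions and output ⟪M⟫ • ⟪N⟫ = ⟪M · N⟫ on a.
-- The restrictions on b and d are then discarded: ⟪·⟫ and ℛ only mention
-- the reserved names S and F, so b and d no longer occur free.

open import Defs
open import Data.Nat using (ℕ; zero; suc; _+_; _≤_; _<_; s≤s)
open import Data.Nat.Properties
  using (≡ᵇ⇒≡; ≡⇒≡ᵇ; <⇒≢; <-≤-trans; m≤n+m; n≤1+n; n<1+n; ≤-refl)
open import Data.Bool using (true; false)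
open import Data.Bool.Properties using (T-≡; ¬-not)
open import Data.List using ([]; _∷_; _++_)
open import Data.List.Properties using (++-assoc)
open import Data.List.Membership.Propositional using (_∈_)
open import Data.List.Membership.Propositional.Properties using (∈-++⁻)
open import Data.List.Relation.Unary.Any using (here; there)
open import Data.List.Relation.Unary.All as All using (all?)
open import Data.Maybe using (just)
open import Data.Product using (_×_; _,_; ∃-syntax)
open import Data.Sum using (_⊎_; inj₁; inj₂)
open import Data.Empty using (⊥-elim)
open import Function.Bundles using (Equivalence)
open import Relation.Nullary using (¬_; Dec; yes; no)
open import Relation.Nullary.Decidable using (toWitness)
open import Relation.Binary.PropositionalEquality
  using (_≡_; _≢_; refl; sym; cong)
open import Relation.Binary.Construct.Closure.ReflexiveTransitive
  using (ε; _◅_; _◅◅_; gmap)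

-- Boolean equality of names is reflexive and false on distinct names; this is
-- what lets the substitutions and unifications below compute.
==-refl : ∀ a → (a == a) ≡ true
==-refl nS     = refl
==-refl nF     = refl
==-refl (nm i) = Equivalence.to T-≡ (≡⇒≡ᵇ i i refl)

==-false : ∀ a b → a ≢ b → (a == b) ≡ false
==-false nS     nS     a≢b = ⊥-elim (a≢b refl)
==-false nF     nF     a≢b = ⊥-elim (a≢b refl)
==-false (nm i) (nm j) a≢b =
  ¬-not λ i==j → a≢b (cong nm (≡ᵇ⇒≡ i j (Equivalence.from T-≡ i==j)))
==-false nS     nF     _   = refl
==-false nS     (nm _) _   = refl
==-false nF     nS     _   = refl
==-false nF     (nm _) _   = refl
==-false (nm _) nS     _   = refl
==-false (nm _) nF     _   = refl

-- ⟪M⟫ is built from the variables S and F alone, so it can be communicated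
-- (it may instantiate a binding name) ...
isComm-⟪⟫ : ∀ M → isComm ⟪ M ⟫ ≡ true
isComm-⟪⟫ S       = refl
isComm-⟪⟫ F       = refl
isComm-⟪⟫ (M · N) rewrite isComm-⟪⟫ M | isComm-⟪⟫ N = refl

bn-⟪⟫ : ∀ M → bn ⟪ M ⟫ ≡ []
bn-⟪⟫ S       = refl
bn-⟪⟫ F       = refl
bn-⟪⟫ (M · N) rewrite bn-⟪⟫ M | bn-⟪⟫ N = refl

substPat-⟪⟫ : ∀ j t M → substPat ((nm j , t) ∷ []) ⟪ M ⟫ ≡ just ⟪ M ⟫
substPat-⟪⟫ j t S       = refl
substPat-⟪⟫ j t F       = refl
substPat-⟪⟫ j t (M · N) rewrite substPat-⟪⟫ j t M | substPat-⟪⟫ j t N = refl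

∈ᵇ-fnPat-⟪⟫ : ∀ i M ys → (nm i ∈ᵇ (fnPat ⟪ M ⟫ ++ ys)) ≡ (nm i ∈ᵇ ys)
∈ᵇ-fnPat-⟪⟫ i S       ys = refl
∈ᵇ-fnPat-⟪⟫ i F       ys = refl
∈ᵇ-fnPat-⟪⟫ i (M · N) ys
  rewrite ++-assoc (fnPat ⟪ M ⟫) (fnPat ⟪ N ⟫) ys
        | ∈ᵇ-fnPat-⟪⟫ i M (fnPat ⟪ N ⟫ ++ ys) = ∈ᵇ-fnPat-⟪⟫ i N ys

unify-receive : ∀ x u M →
  unify (var x • bind u) (var x • ⟪ M ⟫) ≡ just ((u , ⟪ M ⟫) ∷ [] , [])
unify-receive x u M rewrite ==-refl x | isComm-⟪⟫ M = refl

-- The substitution is defined because v is distinct from u and not free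
-- in ⟪M⟫ (so nothing is captured), and it only touches the occurrence of u.
-- (The test u == v occurs twice: once for capture, once for restriction.)
subst-first : ∀ a d i j M → nm i ≢ nm j → d ≢ nm i → a ≢ nm i →
  subst ((nm i , ⟪ M ⟫) ∷ [])
        (case (var d • bind (nm j)) (out a (var (nm i) • var (nm j))))
    ≡ just (case (var d • bind (nm j)) (out a (⟪ M ⟫ • var (nm j))))
subst-first a d i j M i≢j d≢i a≢i
  rewrite ==-false _ _ i≢j | ∈ᵇ-fnPat-⟪⟫ j M [] | ==-false _ _ d≢i
        | ==-false _ _ i≢j | ==-false _ _ a≢i | ==-refl (nm i)
        | ==-false _ _ (λ j≡i → i≢j (sym j≡i)) = refl

subst-second : ∀ a j M N → a ≢ nm j →
  subst ((nm j , ⟪ N ⟫) ∷ []) (out a (⟪ M ⟫ • var (nm j)))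
    ≡ just (out a ⟪ M · N ⟫)
subst-second a j M N a≢j
  rewrite bn-⟪⟫ M | ==-false _ _ a≢j | substPat-⟪⟫ j ⟪ N ⟫ M
        | ==-refl (nm j) = refl

Reserved : Name → Set
Reserved z = z ≡ nS ⊎ z ≡ nF

-- Being reserved is decidable, so closedness of Rbase can be computed.
reserved? : (z : Name) → Dec (Reserved z)
reserved? nS     = yes (inj₁ refl)
reserved? nF     = yes (inj₂ refl)
reserved? (nm i) = no λ { (inj₁ ()) ; (inj₂ ()) }

ordinary-not-reserved : ∀ i → ¬ Reserved (nm i)
ordinary-not-reserved i (inj₁ ())
ordinary-not-reserved i (inj₂ ())

fnPat-⟪⟫ : ∀ M z → z ∈ fnPat ⟪ M ⟫ → Reserved z
fnPat-⟪⟫ S       z (here refl) = inj₁ refl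
fnPat-⟪⟫ F       z (here refl) = inj₂ refl
fnPat-⟪⟫ (M · N) z z∈ with ∈-++⁻ (fnPat ⟪ M ⟫) z∈
... | inj₁ z∈M = fnPat-⟪⟫ M z z∈M
... | inj₂ z∈N = fnPat-⟪⟫ N z z∈N

-- Every free name of the explicit cases Rbase is S or F (checked by evaluation).
closed-Rbase : Closed Rbase
closed-Rbase z = All.lookup (toWitness {a? = all? reserved? (fn Rbase)} _)

closed-∣ : ∀ {P Q} → Closed P → Closed Q → Closed (P ∣ Q)
closed-∣ {P} cP cQ z z∈ with ∈-++⁻ (fn P) z∈
... | inj₁ z∈P = cP z z∈P
... | inj₂ z∈Q = cQ z z∈Q

closed-copies : ∀ {P} k → Closed P → Closed (copies P k)
closed-copies zero    cP = cP
closed-copies {P} (suc k) cP = closed-∣ {P} {copies P k} cP (closed-copies k cP)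

out-∣-closed : ∀ {a P} i M → nm i ≢ a → Closed P → ¬ (nm i ∈ fn (out a ⟪ M ⟫ ∣ P))
out-∣-closed {a} {P} i M i≢a cP i∈ with ∈-++⁻ ((a ∷ fnPat ⟪ M ⟫) ++ []) i∈
... | inj₂ i∈P = ordinary-not-reserved i (cP (nm i) i∈P)
... | inj₁ i∈out with ∈-++⁻ (a ∷ fnPat ⟪ M ⟫) i∈out
...   | inj₂ ()
...   | inj₁ (here i≡a) = i≢a i≡a
...   | inj₁ (there i∈M) = ordinary-not-reserved i (fnPat-⟪⟫ M (nm i) i∈M)

ν-gc : ∀ {x P} → ¬ (x ∈ fn P) → ν x P ≈ P
ν-gc x∉P =
  ≈-trans (cong-nu (≈-sym par-unit))
    (≈-trans (≈-sym (extrude x∉P)) (≈-trans (cong-par ≈-refl nu-nil) par-unit))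

par-exchange : ∀ {X D E} → (X ∣ (D ∣ E)) ≈ (D ∣ (X ∣ E))
par-exchange = ≈-trans par-assoc (≈-trans (cong-par par-comm ≈-refl) (≈-sym par-assoc))

-- Bring the output C next to the receiving case A (first interaction of ap).
gather-first : ∀ {A B C D E} → ((A ∣ B) ∣ ((C ∣ D) ∣ E)) ≈ ((A ∣ C) ∣ (B ∣ (D ∣ E)))
gather-first =
  ≈-trans (cong-par ≈-refl (≈-sym par-assoc))
    (≈-trans (≈-sym par-assoc) (≈-trans (cong-par ≈-refl par-exchange) par-assoc))

-- Bring the output D next to the residual case A (second interaction of ap).
gather-second : ∀ {A B C D E} → ((A ∣ 𝟎) ∣ (B ∣ (C ∣ (D ∣ E)))) ≈ ((A ∣ D) ∣ (B ∣ (C ∣ E)))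
gather-second =
  ≈-trans (cong-par par-unit (≈-trans (cong-par ≈-refl par-exchange) par-exchange)) par-assoc

copies-∣ : ∀ Q i j → (copies Q i ∣ copies Q j) ≈ copies Q (suc (i + j))
copies-∣ Q zero    j = ≈-refl
copies-∣ Q (suc i) j = ≈-trans (≈-sym par-assoc) (cong-par ≈-refl (copies-∣ Q i j))

⟶*-left : ∀ {P P' Q} → P ⟶* P' → (P ∣ Q) ⟶* (P' ∣ Q)
⟶*-left = gmap _ red-par

⟶*-right : ∀ {P Q Q'} → Q ⟶* Q' → (P ∣ Q) ⟶* (P ∣ Q')
⟶*-right = gmap _ (λ Q⟶Q' → red-str par-comm (red-par Q⟶Q') par-comm)

⟶*-par : ∀ {P P' Q Q'} → P ⟶* P' → Q ⟶* Q' → (P ∣ Q) ⟶* (P' ∣ Q')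
⟶*-par P⟶*P' Q⟶*Q' = ⟶*-left P⟶*P' ◅◅ ⟶*-right Q⟶*Q'

⟶*-ν : ∀ {x P P'} → P ⟶* P' → ν x P ⟶* ν x P'
⟶*-ν = gmap _ red-nu

ap-fires : ∀ {ℛ a b d i j M N QM QN X Y} →
  nm i ≢ nm j → d ≢ nm i → a ≢ nm i → a ≢ nm j →
  QM ≈ (out b ⟪ M ⟫ ∣ X) → QN ≈ (out d ⟪ N ⟫ ∣ Y) →
  (ap ℛ a b d (nm i) (nm j) ∣ (QM ∣ QN)) ⟶* (out a ⟪ M · N ⟫ ∣ (ℛ ∣ (X ∣ Y)))
ap-fires {a = a} {b} {d} {i} {j} {M} {N} i≢j d≢i a≢i a≢j QM≈ QN≈ =
    red-str (≈-trans (cong-par ≈-refl (cong-par QM≈ ≈-refl)) gather-first)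
            (red-par receive-M) ≈-refl
  ◅ red-str (≈-trans (cong-par ≈-refl (cong-par ≈-refl (cong-par ≈-refl QN≈))) gather-second)
            (red-par receive-N) (cong-par par-unit ≈-refl)
  ◅ ε
  where
  receive-M : (case (var b • bind (nm i)) (case (var d • bind (nm j)) (out a (var (nm i) • var (nm j))))
                ∣ out b ⟪ M ⟫)
              ⟶ (case (var d • bind (nm j)) (out a (⟪ M ⟫ • var (nm j))) ∣ 𝟎)
  receive-M = interact (unify-receive b (nm i) M) (subst-first a d i j M i≢j d≢i a≢i) refl
  receive-N : (case (var d • bind (nm j)) (out a (⟪ M ⟫ • var (nm j))) ∣ out d ⟪ N ⟫)
              ⟶ (out a ⟪ M · N ⟫ ∣ 𝟎)
  receive-N = interact (unify-receive d (nm j) N) (subst-second a j M N a≢j) refl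

Fresh : Name → ℕ → Set
Fresh a k = ∀ j → k ≤ j → a ≢ nm j

nm-< : ∀ {i j} → i < j → nm i ≢ nm j
nm-< i<j nmi≡nmj = <⇒≢ i<j (cong idx nmi≡nmj)

fresh-< : ∀ {i k} → i < k → Fresh (nm i) k
fresh-< i<k j k≤j = nm-< (<-≤-trans i<k k≤j)

fresh-start : ∀ c → Fresh c (suc (idx c))
fresh-start nS     j _ ()
fresh-start nF     j _ ()
fresh-start (nm i) j   = fresh-< (n<1+n i) j

module _ (Rsub : Proc) (closed-Rsub : Closed Rsub) where

  ℛ : Proc
  ℛ = R Rsub

  closed-ℛ : Closed ℛ
  closed-ℛ = closed-∣ {Rbase} {Rsub} closed-Rbase closed-Rsub

  translation-outputs : ∀ M a k → Fresh a k →
    ∃[ Q ] ∃[ n ] ((tr ℛ M a k ⟶* Q) × (Q ≈ (out a ⟪ M ⟫ ∣ copies ℛ n)))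
  translation-outputs S a k _ = _ , 0 , ε , ≈-refl
  translation-outputs F a k _ = _ , 0 , ε , ≈-refl
  translation-outputs (M · N) a k fresh
    with translation-outputs M (nm k) (4 + k) (fresh-< (s≤s (m≤n+m k 3)))
       | translation-outputs N (nm (suc k)) (4 + k) (fresh-< (s≤s (s≤s (m≤n+m k 2))))
  ... | QM , nM , M⟶*QM , QM≈ | QN , nN , N⟶*QN , QN≈ =
    _ , suc (suc (nM + nN)) , reduction , restrictions-discarded
    where
    b d : Name
    b = nm k
    d = nm (suc k)

    -- the copies of ℛ left over: those of both components and ap's own
    rest : Proc
    rest = copies ℛ (suc (suc (nM + nN)))

    reduction : tr ℛ (M · N) a k ⟶* ν b (ν d (out a ⟪ M · N ⟫ ∣ (ℛ ∣ (copies ℛ nM ∣ copies ℛ nN))))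
    reduction =
      ⟶*-ν (⟶*-ν (⟶*-right (⟶*-par M⟶*QM N⟶*QN)
        ◅◅ ap-fires (nm-< (n<1+n (2 + k))) (nm-< (n<1+n (suc k)))
                    (fresh (2 + k) (m≤n+m k 2)) (fresh (3 + k) (m≤n+m k 3)) QM≈ QN≈))

    closed-rest : Closed rest
    closed-rest = closed-copies {ℛ} (suc (suc (nM + nN))) closed-ℛ

    -- b and d are not free in  out a ⟪M · N⟫ ∣ rest, as a is fresh and rest closed
    b∉ : ¬ (b ∈ fn (out a ⟪ M · N ⟫ ∣ rest))
    b∉ = out-∣-closed {P = rest} k (M · N) (λ b≡a → fresh k ≤-refl (sym b≡a)) closed-rest

    d∉ : ¬ (d ∈ fn (out a ⟪ M · N ⟫ ∣ rest))
    d∉ = out-∣-closed {P = rest} (suc k) (M · N)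
                      (λ d≡a → fresh (suc k) (n≤1+n k) (sym d≡a)) closed-rest

    restrictions-discarded :
      ν b (ν d (out a ⟪ M · N ⟫ ∣ (ℛ ∣ (copies ℛ nM ∣ copies ℛ nN)))) ≈ (out a ⟪ M · N ⟫ ∣ rest)
    restrictions-discarded =
      ≈-trans (cong-nu (cong-nu (cong-par ≈-refl (cong-par ≈-refl (copies-∣ ℛ nM nN)))))
        (≈-trans (cong-nu (ν-gc d∉)) (ν-gc b∉))

lemma8 : (Rsub : Proc) → Closed Rsub → (M : SF) (c : Name) →
    ∃[ Q ] ∃[ k ] ((⟦ M ⟧ c Rsub ⟶* Q) × (Q ≈ (out c ⟪ M ⟫ ∣ copies (R Rsub) k)))
lemma8 Rsub closed-Rsub M c =
  translation-outputs Rsub closed-Rsub M c (suc (idx c)) (fresh-start c)
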